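{- Let $\mathcal S,\mathcal P\subseteq\mathcal G$ be group properties with $\mathcal P\subseteq\mathcal S$. If for every $G\in\mathcal S$ there is some $H\in\mathcal P$ such that $\overline G$ can be embedded into $\overline H$, then $\mathcal P$ is dense in $\mathcal S$.
   Context: Let $\mathbb N=\{1,2,3,\dots\}$. Equip $\mathbb N^{\mathbb N\times\mathbb N}$ with the product of the discrete topologies. Let $\mathcal G$ be the subspace consisting of tables that are the multiplication table of a group on $\mathbb N$ with identity element $1$ (subspace topology). For $G\in\mathcal G$, $\overline G$ denotes the group on $\mathbb N$ with multiplication table $G$. A group property is a subset $\mathcal P\subseteq\mathcal G$ such that whenever $G\in\mathcal G$, $H\in\mathcal P$ and $\overline G\cong\overline H$, then $G\in\mathcal P$. -}

module Defs where

open import Data.Nat using (ℕ; zero; suc)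
open import Data.Product using (Σ; _×_; _,_)
open import Data.List using (List)
open import Data.List.Membership.Propositional using (_∈_)
open import Relation.Binary.PropositionalEquality using (_≡_)

-- Encoding convention: the paper's ℕ = {1,2,3,...} is represented by
-- Agda's ℕ via n ↦ n - 1; so the paper's element k is the Agda number
-- k - 1, and the paper's identity element 1 is Agda's `zero`.

Table : Set
Table = ℕ → ℕ → ℕ

record IsGroupTable (G : Table) : Set where
  field
    assoc    : ∀ x y z → G (G x y) z ≡ G x (G y z)
    identityˡ : ∀ x → G zero x ≡ x
    identityʳ : ∀ x → G x zero ≡ x
    inverse  : ∀ x → Σ ℕ (λ y → (G x y ≡ zero) × (G y x ≡ zero))

record Iso (G H : Table) : Set where
  field
    to      : ℕ → ℕ
    from    : ℕ → ℕ
    from-to : ∀ x → from (to x) ≡ x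
    to-from : ∀ y → to (from y) ≡ y
    hom     : ∀ x y → to (G x y) ≡ H (to x) (to y)

record Embedding (G H : Table) : Set where
  field
    to    : ℕ → ℕ
    inj   : ∀ x y → to x ≡ to y → x ≡ y
    hom   : ∀ x y → to (G x y) ≡ H (to x) (to y)

record IsGroupProperty (P : Table → Set) : Set where
  field
    ⊆𝒢      : ∀ G → P G → IsGroupTable G
    iso-closed : ∀ G H → IsGroupTable G → P H → Iso G H → P G

_⊆_ : (Table → Set) → (Table → Set) → Set
P ⊆ S = ∀ G → P G → S G

-- Tables agreeing on a finite set of coordinates (basic open neighbourhoods
-- of the product of discrete topologies).
AgreeOn : List (ℕ × ℕ) → Table → Table → Set
AgreeOn F G H = ∀ i j → (i , j) ∈ F → H i j ≡ G i j

-- 𝒫 is dense in 𝒮 (w.r.t. the subspace topology on 𝒮): every basic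
-- neighbourhood of every point of 𝒮 meets 𝒫.
DenseIn : (Table → Set) → (Table → Set) → Set
DenseIn P S = ∀ G → S G → ∀ (F : List (ℕ × ℕ)) → Σ Table (λ H → P H × AgreeOn F G H)

{-# OPTIONS --safe #-}
-- Given G ∈ 𝒮 and a finite set F of coordinates, embed Ḡ into some H̄ with
-- H ∈ 𝒫 via e.  Only finitely many elements of ℕ matter for F (the entries
-- i, j, G i j and the identity), and e is injective on them, so e agrees there
-- with a permutation σ of ℕ fixing the identity.  Relabelling H along σ gives an
-- isomorphic table, hence one in 𝒫, and on F it reproduces G because e is a
-- homomorphism.
module Submission where

open import Defs
open import Data.Nat using (ℕ; zero; _≟_)
open import Data.Product using (Σ; ∃; _×_; _,_)
open import Data.List using (List; []; _∷_)
open import Data.List.Membership.Propositional using (_∈_)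
open import Data.List.Relation.Unary.Any using (here; there)
open import Data.Empty using (⊥-elim)
open import Function.Bundles using (_↔_; mk↔ₛ′; Inverse; Injection)
open import Function.Construct.Composition using (_↔-∘_)
open import Function.Construct.Identity using (↔-id)
open import Function.Definitions using (Injective)
open import Function.Properties.Inverse using (↔⇒↣)
open import Relation.Binary.Definitions using (DecidableEquality)
open import Relation.Nullary using (yes; no; ¬_)
open import Relation.Binary.PropositionalEquality
open ≡-Reasoning

module _ {a} {A : Set a} (_≟_ : DecidableEquality A) where

  transpose : A → A → A → A
  transpose u v w with w ≟ u | w ≟ v
  ... | yes _ | _     = v
  ... | no _  | yes _ = u
  ... | no _  | no _  = w

  transpose-matchˡ : ∀ u v → transpose u v u ≡ v
  transpose-matchˡ u v with u ≟ u
  ... | yes _  = refl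
  ... | no u≢u = ⊥-elim (u≢u refl)

  transpose-matchʳ : ∀ u v → transpose u v v ≡ u
  transpose-matchʳ u v with v ≟ u | v ≟ v
  ... | yes v≡u | _      = v≡u
  ... | no _    | yes _  = refl
  ... | no _    | no v≢v = ⊥-elim (v≢v refl)

  transpose-others : ∀ {u v w} → ¬ w ≡ u → ¬ w ≡ v → transpose u v w ≡ w
  transpose-others {u} {v} {w} w≢u w≢v with w ≟ u | w ≟ v
  ... | yes w≡u | _       = ⊥-elim (w≢u w≡u)
  ... | no _    | yes w≡v = ⊥-elim (w≢v w≡v)
  ... | no _    | no _    = refl

  transpose-involutive : ∀ u v w → transpose u v (transpose u v w) ≡ w
  transpose-involutive u v w with w ≟ u | w ≟ v
  ... | yes refl | _        = transpose-matchʳ u v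
  ... | no _     | yes refl = transpose-matchˡ u v
  ... | no w≢u   | no w≢v   = transpose-others w≢u w≢v

  transposition : A → A → A ↔ A
  transposition u v = mk↔ₛ′ (transpose u v) (transpose u v)
    (transpose-involutive u v) (transpose-involutive u v)

  -- Put f a in place by swapping it with the current image of a; images of the
  -- other listed points are untouched since f is injective.
  injection-agrees-with-permutation : (f : A → A) → Injective _≡_ _≡_ f →
    (L : List A) → ∃ λ (σ : A ↔ A) → ∀ x → x ∈ L → Inverse.to σ x ≡ f x
  injection-agrees-with-permutation f f-inj [] = ↔-id A , λ _ ()
  injection-agrees-with-permutation f f-inj (a ∷ L)
    with injection-agrees-with-permutation f f-inj L
  ... | σ , σ≗f = transposition (π a) (f a) ↔-∘ σ , agrees
    where
    π = Inverse.to σ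

    agrees : ∀ x → x ∈ a ∷ L → transpose (π a) (f a) (π x) ≡ f x
    agrees x (here refl) = transpose-matchˡ (π x) (f x)
    agrees x (there x∈L) with x ≟ a
    ... | yes refl = transpose-matchˡ (π x) (f x)
    ... | no x≢a   = begin
      transpose (π a) (f a) (π x) ≡⟨ cong (transpose (π a) (f a)) (σ≗f x x∈L) ⟩
      transpose (π a) (f a) (f x) ≡⟨ transpose-others fx≢πa (λ fx≡fa → x≢a (f-inj fx≡fa)) ⟩
      f x                         ∎
      where
      fx≢πa : ¬ f x ≡ π a
      fx≢πa fx≡πa = x≢a (Injection.injective (↔⇒↣ σ) (trans (σ≗f x x∈L) fx≡πa))

module _ {H : Table} (H-group : IsGroupTable H) where
  open IsGroupTable H-group

  idempotent⇒identity : ∀ {x} → H x x ≡ x → x ≡ zero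
  idempotent⇒identity {x} xx≡x with inverse x
  ... | y , _ , yx≡0 = begin
    x           ≡⟨ sym (identityˡ x) ⟩
    H zero x    ≡⟨ cong (λ z → H z x) (sym yx≡0) ⟩
    H (H y x) x ≡⟨ assoc y x x ⟩
    H y (H x x) ≡⟨ cong (H y) xx≡x ⟩
    H y x       ≡⟨ yx≡0 ⟩
    zero        ∎

embedding-preserves-identity : ∀ {G H} → IsGroupTable G → IsGroupTable H →
  (E : Embedding G H) → Embedding.to E zero ≡ zero
embedding-preserves-identity {G} {H} G-group H-group E = idempotent⇒identity H-group (begin
  H (e zero) (e zero) ≡⟨ sym (hom zero zero) ⟩
  e (G zero zero)     ≡⟨ cong e (IsGroupTable.identityˡ G-group zero) ⟩
  e zero              ∎)
  where open Embedding E renaming (to to e)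

module _ (σ : ℕ ↔ ℕ) where
  open Inverse σ using (to; from)
    renaming (strictlyInverseˡ to to-from; strictlyInverseʳ to from-to)

  relabel : Table → Table
  relabel H x y = from (H (to x) (to y))

  relabel-iso : ∀ H → Iso (relabel H) H
  relabel-iso H = record
    { to = to ; from = from ; from-to = from-to ; to-from = to-from
    ; hom = λ x y → to-from (H (to x) (to y)) }

  relabel-isGroupTable : ∀ {H} → IsGroupTable H → to zero ≡ zero →
    IsGroupTable (relabel H)
  relabel-isGroupTable {H} H-group to0≡0 = record
    { assoc     = assoc′
    ; identityˡ = λ x → trans (cong (λ z → from (H z (to x))) to0≡0)
                              (trans (cong from (identityˡ (to x))) (from-to x))
    ; identityʳ = λ x → trans (cong (λ z → from (H (to x) z)) to0≡0)
                              (trans (cong from (identityʳ (to x))) (from-to x))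
    ; inverse   = inverse′
    }
    where
    open IsGroupTable H-group
    H′ = relabel H

    from0≡0 : from zero ≡ zero
    from0≡0 = trans (cong from (sym to0≡0)) (from-to zero)

    assoc′ : ∀ x y z → H′ (H′ x y) z ≡ H′ x (H′ y z)
    assoc′ x y z = cong from (begin
      H (to (from (H (to x) (to y)))) (to z) ≡⟨ cong (λ w → H w (to z)) (to-from _) ⟩
      H (H (to x) (to y)) (to z)             ≡⟨ assoc (to x) (to y) (to z) ⟩
      H (to x) (H (to y) (to z))             ≡⟨ cong (H (to x)) (to-from _) ⟨
      H (to x) (to (from (H (to y) (to z)))) ∎)

    inverse′ : ∀ x → Σ ℕ (λ y → (H′ x y ≡ zero) × (H′ y x ≡ zero))
    inverse′ x with inverse (to x)
    ... | y , xy≡0 , yx≡0 = from y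
      , trans (cong (λ w → from (H (to x) w)) (to-from y)) (trans (cong from xy≡0) from0≡0)
      , trans (cong (λ w → from (H w (to x))) (to-from y)) (trans (cong from yx≡0) from0≡0)

  relabel-agrees-with-embedding : ∀ {G H} (E : Embedding G H) {i j} →
    let e = Embedding.to E in
    to i ≡ e i → to j ≡ e j → to (G i j) ≡ e (G i j) → relabel H i j ≡ G i j
  relabel-agrees-with-embedding {G} {H} E {i} {j} i≡ j≡ Gij≡ = begin
    from (H (to i) (to j)) ≡⟨ cong₂ (λ x y → from (H x y)) i≡ j≡ ⟩
    from (H (e i) (e j))   ≡⟨ cong from (hom i j) ⟨
    from (e (G i j))       ≡⟨ cong from Gij≡ ⟨
    from (to (G i j))      ≡⟨ from-to (G i j) ⟩
    G i j                  ∎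
    where open Embedding E renaming (to to e)

entries : Table → List (ℕ × ℕ) → List ℕ
entries G []             = zero ∷ []
entries G ((i , j) ∷ F) = i ∷ j ∷ G i j ∷ entries G F

zero∈entries : ∀ G F → zero ∈ entries G F
zero∈entries G []             = here refl
zero∈entries G ((i , j) ∷ F) = there (there (there (zero∈entries G F)))

∈entries : ∀ G {F i j} → (i , j) ∈ F →
  i ∈ entries G F × j ∈ entries G F × G i j ∈ entries G F
∈entries G (here refl) = here refl , there (here refl) , there (there (here refl))
∈entries G {(_ , _) ∷ _} (there ij∈F) with ∈entries G ij∈F
... | i∈ , j∈ , Gij∈ =
  there (there (there i∈)) , there (there (there j∈)) , there (there (there Gij∈))

isomorphic-copy-agreeing-on : ∀ {G H} → IsGroupTable G → IsGroupTable H →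
  Embedding G H → (F : List (ℕ × ℕ)) →
  ∃ λ H′ → IsGroupTable H′ × Iso H′ H × AgreeOn F G H′
isomorphic-copy-agreeing-on {G} {H} G-group H-group E F
  with injection-agrees-with-permutation _≟_ (Embedding.to E)
         (λ {x} {y} → Embedding.inj E x y) (entries G F)
... | σ , σ≗e = relabel σ H , relabel-isGroupTable σ H-group σ0≡0 , relabel-iso σ H , agrees
  where
  σ0≡0 : Inverse.to σ zero ≡ zero
  σ0≡0 = trans (σ≗e zero (zero∈entries G F)) (embedding-preserves-identity G-group H-group E)

  agrees : AgreeOn F G (relabel σ H)
  agrees i j ij∈F with ∈entries G ij∈F
  ... | i∈ , j∈ , Gij∈ = relabel-agrees-with-embedding σ E (σ≗e i i∈) (σ≗e j j∈) (σ≗e _ Gij∈)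

mainTheorem16 : (S P : Table → Set) → IsGroupProperty S → IsGroupProperty P → P ⊆ S →
    (∀ G → S G → Σ Table (λ H → P H × Embedding G H)) →
    DenseIn P S
mainTheorem16 S P S-prop P-prop _ embeds G SG F with embeds G SG
... | H , PH , E
  with isomorphic-copy-agreeing-on (IsGroupProperty.⊆𝒢 S-prop G SG)
                                   (IsGroupProperty.⊆𝒢 P-prop H PH) E F
... | H′ , H′-group , H′≅H , agrees =
  H′ , IsGroupProperty.iso-closed P-prop H′ H H′-group PH H′≅H , agrees
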